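{- Let $l\geq2$ and let $H$ be an $l$-modest hypergraph. Then (i) for every $k$ with $2k\leq 2l$, every minimal dense vertex set of cardinality $2k$ is the set of vertices of a witnessed cycle of length $k$; and (ii) for every $k\le l$, the set of vertices of every witnessed cycle of length $k$ is a minimal dense set of cardinality $2k$.
   Context: A hypergraph is a pair $H=(U,T)$ with $U$ a finite nonempty vertex set and $T$ a collection of 3-element subsets of $U$ (hyperedges). For nonempty $X\subseteq U$, $\|X\|$ is its cardinality and $[X]$ (weight) is the number of hyperedges contained in $X$. $X$ is dense if $\|X\|\leq 2[X]$ and super-dense if $\|X\|<2[X]$; a minimal dense set is a dense set no proper nonempty subset of which is dense. $H$ is $l$-modest if it has no super-dense vertex sets of cardinality $\leq 2l$. Vertices $x,y$ are adjacent if there is a hyperedge $\{x,y,z\}$; $z$ witnesses the adjacency. A sequence $x_1,\dots,x_k$ of $k\geq3$ distinct vertices (indices mod $k$) is a weak cycle if each $x_i$ is adjacent to $x_{i+1}$ and either $k>3$ or $\{x_1,x_2,x_3\}$ is not a hyperedge; it is a cycle of length $k$ if moreover no $\{x_i,x_{i+1},x_{i+2}\}$ is a hyperedge; a corresponding witnessed cycle of length $k$ is a vertex sequence $x_1,\dots,x_k,y_1,\dots,y_k$ where each $y_i$ witnesses that $x_i$ is adjacent to $x_{i+1}$. A sequence $x_1,x_2$ is a cycle of length 2 if there are distinct vertices $y_1,y_2$ different from $x_1,x_2$ with $\{x_1,x_2,y_1\}$ and $\{x_1,x_2,y_2\}$ hyperedges; then $x_1,x_2,y_1,y_2$ is a corresponding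 witnessed cycle of length 2. -}

module Defs where

open import Data.Nat using (ℕ; zero; suc; _+_; _*_; _≤_; _<_; NonZero)
open import Data.Nat.DivMod using (_%_; m%n<n)
open import Data.Fin using (Fin; fromℕ<)
open import Data.Fin.Subset using (Subset; ⁅_⁆; _∪_; ⋃; ∣_∣; _⊆_; Nonempty)
open import Data.Fin.Subset.Properties using (_⊆?_)
open import Data.List using (List; length; filter; tabulate)
open import Data.List.Membership.Propositional using (_∈_)
open import Data.List.Relation.Unary.All using (All)
open import Data.List.Relation.Unary.Unique.Propositional using (Unique)
open import Data.Empty using (⊥)
open import Data.Product using (_×_)
open import Function.Definitions using (Injective)
open import Relation.Nullary using (¬_)
open import Relation.Binary.PropositionalEquality using (_≡_; _≢_)

record Hypergraph : Set where
  field
    n        : ℕ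
    .{{nz}}  : NonZero n
    edges    : List (Subset n)
    edges-3  : All (λ e → ∣ e ∣ ≡ 3) edges
    edges-uniq : Unique edges
open Hypergraph public

module _ (H : Hypergraph) where
  private
    N = n H

  weight : Subset N → ℕ
  weight X = length (filter (λ e → e ⊆? X) (edges H))

  Dense : Subset N → Set
  Dense X = ∣ X ∣ ≤ 2 * weight X

  SuperDense : Subset N → Set
  SuperDense X = ∣ X ∣ < 2 * weight X

  MinimalDense : Subset N → Set
  MinimalDense X = Nonempty X × Dense X ×
    (∀ Y → Y ⊆ X → Y ≢ X → Nonempty Y → ¬ Dense Y)

  Modest : ℕ → Set
  Modest l = ∀ X → Nonempty X → ∣ X ∣ ≤ 2 * l → ¬ SuperDense X

  IsEdge : Fin N → Fin N → Fin N → Set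
  IsEdge a b c = (⁅ a ⁆ ∪ ⁅ b ⁆ ∪ ⁅ c ⁆) ∈ edges H

  at : (k : ℕ) .{{_ : NonZero k}} → ℕ → Fin k
  at k i = fromℕ< (m%n<n i k)

  WitnessedCycleCond : (k : ℕ) → (Fin k → Fin N) → (Fin k → Fin N) → Set
  WitnessedCycleCond zero x y = ⊥
  WitnessedCycleCond (suc zero) x y = ⊥
  WitnessedCycleCond (suc (suc zero)) x y =
    let x₁ = x (at 2 0) ; x₂ = x (at 2 1) ; y₁ = y (at 2 0) ; y₂ = y (at 2 1) in
    x₁ ≢ x₂ × y₁ ≢ y₂ × y₁ ≢ x₁ × y₁ ≢ x₂ × y₂ ≢ x₁ × y₂ ≢ x₂ ×
    IsEdge x₁ x₂ y₁ × IsEdge x₁ x₂ y₂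
  WitnessedCycleCond k@(suc (suc (suc _))) x y =
    Injective _≡_ _≡_ x ×
    (∀ i → IsEdge (x (at k i)) (x (at k (suc i))) (y (at k i))) ×
    (∀ i → ¬ IsEdge (x (at k i)) (x (at k (suc i))) (x (at k (suc (suc i)))))

  record WitnessedCycle (k : ℕ) : Set where
    field
      x : Fin k → Fin N
      y : Fin k → Fin N
      cond : WitnessedCycleCond k x y

  cycleVertices : ∀ {k} → WitnessedCycle k → Subset N
  cycleVertices {k} C = ⋃ (tabulate (λ i → ⁅ WitnessedCycle.x C i ⁆ ∪ ⁅ WitnessedCycle.y C i ⁆))

-- Modesty forces equality in the density bound: a minimal dense set X with ∣ X ∣ = 2k spans exactly
-- k edges. Deleting a vertex lying in no edge, or two private vertices (vertices lying in a single
-- edge) of one edge, would leave a smaller dense set. Double counting the 3k vertex–edge incidences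
-- then shows that every edge has exactly one private vertex and two non-private ones, each of which
-- lies in exactly two edges. Walking from edge to edge through the non-private vertices closes up into
-- a witnessed cycle; its vertices form a dense subset of X, hence all of X.
--
-- Conversely, the k distinct edges of a witnessed cycle of length k lie inside its at most 2k vertices,
-- so modesty gives exactly 2k vertices and no further edges. A proper subset Y containing the edges
-- with indices in I contains the 2 ∣ I ∣ vertices those edges contribute, plus one vertex where the
-- cycle enters Y, so Y is not dense.

module Submission where

open import Defs
open import Data.Bool using (true; false)
import Data.Bool as Bool
open import Data.Empty using (⊥; ⊥-elim)
open import Data.Fin as Fin using (Fin; zero; suc; toℕ)
open import Data.Fin.Properties using (toℕ-injective; toℕ-fromℕ<; toℕ<n; any?; all?; ¬∀⟶∃¬; pigeonhole)
  renaming (_≟_ to _≟ꟳ_; suc-injective to sucꟳ-injective)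
open import Data.Fin.Subset using (Subset; ⁅_⁆; _∪_; ⋃; ∣_∣; _⊆_; _⊂_; Nonempty; _-_)
  renaming (_∈_ to _∈ₛ_; _∉_ to _∉ₛ_)
open import Data.Fin.Subset.Properties
  using (_⊆?_; ⊆-antisym; x∈p∪q⁻; x∈p∪q⁺; x∈⁅x⁆; x∈⁅y⁆⇒x≡y; ∉⊥; p─q⊆p; x∈p∧x≢y⇒x∈p-y;
         x∈p⇒∣p-x∣<∣p∣; p⊆q⇒∣p∣≤∣q∣; ⊂-irref; ⊂-⊆-trans; x∈p⇒p-x⊂p)
  renaming (_∈?_ to _∈ₛ?_)
open import Data.List using (List; []; _∷_; length; filter; map; _++_; tabulate; allFin)
open import Data.List.Properties using (filter-all; length-map; length-++; length-tabulate; length-applyUpTo)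
open import Data.List.Membership.Propositional using (_∈_; _∉_)
open import Data.List.Membership.Propositional.Properties
  using (∈-filter⁺; ∈-filter⁻; ∈-map⁺; ∈-map⁻; ∈-tabulate⁺; ∈-tabulate⁻; ∈-++⁺ˡ; ∈-++⁺ʳ; ∈-++⁻; ∈-length;
         ∈-allFin; ∈-applyUpTo⁻)
import Data.List.Membership.DecPropositional as DecMembership
open import Data.List.Relation.Binary.Subset.Propositional using () renaming (_⊆_ to _⊆ₗ_)
open import Data.List.Relation.Unary.Any using (here; there)
open import Data.List.Relation.Unary.All as All using (All; []; _∷_)
import Data.List.Relation.Unary.All.Properties as All
open import Data.List.Relation.Unary.All.Properties using (¬Any⇒All¬)
open import Data.List.Relation.Unary.AllPairs using ([]; _∷_)
open import Data.List.Relation.Unary.Unique.Propositional using (Unique)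
open import Data.List.Relation.Unary.Unique.Propositional.Properties
  using (map⁺; filter⁺; tabulate⁺; allFin⁺; applyUpTo⁺₁; ++⁺)
open import Data.Nat using (ℕ; zero; suc; _+_; _*_; _≤_; _<_; _≤?_; z≤n; s≤s; NonZero; >-nonZero)
  renaming (_≟_ to _≟ℕ_)
open import Data.Nat.DivMod using (_%_; _mod_; m%n<n; m<n⇒m%n≡m; [m+n]%n≡m%n; %-distribˡ-+; m%n%n≡m%n; n%n≡0)
open import Data.Nat.ListAction using (sum)
open import Data.Nat.Properties
open import Data.Nat.Tactic.RingSolver using (solve-∀)
open import Data.Product using (Σ; ∃-syntax; _×_; _,_; proj₁; proj₂)
open import Data.Product.Properties using () renaming (≡-dec to ×-≡-dec)
open import Data.Sum using (_⊎_; inj₁; inj₂; [_,_]′)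
open import Data.Vec.Base using ([]; _∷_)
import Data.Vec.Base as Vec
open import Data.Vec.Properties using () renaming (≡-dec to Vec-≡-dec)
open import Function using (_∘_; case_of_)
open import Relation.Binary.Definitions using (DecidableEquality; tri<; tri≈; tri>)
open import Relation.Binary.PropositionalEquality
  using (_≡_; _≢_; refl; sym; trans; cong; cong₂; subst; subst₂; module ≡-Reasoning)
open import Relation.Nullary using (¬_; Dec; yes; no; ¬?)
open import Relation.Nullary.Decidable using (decidable-stable)

module UniqueSublist {a} {A : Set a} (_≟_ : DecidableEquality A) where
  open DecMembership _≟_ using (_∈?_)

  without : A → List A → List A
  without m = filter (λ x → ¬? (x ≟ m))

  length≤1+length-without : ∀ m {xs} → Unique xs → length xs ≤ suc (length (without m xs))
  length≤1+length-without m {[]} _ = z≤n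
  length≤1+length-without m {x ∷ xs} (x∉xs ∷ xs!) with x ≟ m
  ... | yes refl = s≤s (≤-reflexive (sym (cong length
                   (filter-all (λ y → ¬? (y ≟ x)) (All.map (λ x≢y y≡x → x≢y (sym y≡x)) x∉xs)))))
  ... | no _ = s≤s (length≤1+length-without m xs!)

  ∈-without⁻ : ∀ m {xs v} → v ∈ without m xs → v ∈ xs × v ≢ m
  ∈-without⁻ m {xs} = ∈-filter⁻ (λ x → ¬? (x ≟ m)) {xs = xs}

  without-⊆ : ∀ m {xs ys} → xs ⊆ₗ m ∷ ys → without m xs ⊆ₗ ys
  without-⊆ m xs⊆ v∈ with ∈-without⁻ m v∈
  ... | v∈xs , v≢m with xs⊆ v∈xs
  ... | here v≡m = ⊥-elim (v≢m v≡m)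
  ... | there v∈ys = v∈ys

  Unique-⊆⇒length≤ : ∀ {xs} ys → Unique xs → xs ⊆ₗ ys → length xs ≤ length ys
  Unique-⊆⇒length≤ {[]} ys _ _ = z≤n
  Unique-⊆⇒length≤ {x ∷ xs} [] _ xs⊆ with xs⊆ (here refl)
  ... | ()
  Unique-⊆⇒length≤ (m ∷ ys) xs! xs⊆ =
    ≤-trans (length≤1+length-without m xs!)
            (s≤s (Unique-⊆⇒length≤ ys (filter⁺ _ xs!) (without-⊆ m xs⊆)))

  Unique-⊆-¬Unique⇒length< : ∀ {xs} ys → Unique xs → xs ⊆ₗ ys → ¬ Unique ys → length xs < length ys
  Unique-⊆-¬Unique⇒length< [] _ _ ¬ys! = ⊥-elim (¬ys! [])
  Unique-⊆-¬Unique⇒length< (m ∷ ys) xs! xs⊆ ¬ys! with m ∈? ys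
  ... | yes m∈ys = s≤s (Unique-⊆⇒length≤ ys xs! (λ v∈ → absorb (xs⊆ v∈)))
    where
    absorb : ∀ {v} → v ∈ m ∷ ys → v ∈ ys
    absorb (here refl) = m∈ys
    absorb (there v∈ys) = v∈ys
  ... | no m∉ys = ≤-trans (s≤s (length≤1+length-without m xs!))
    (s≤s (Unique-⊆-¬Unique⇒length< ys (filter⁺ _ xs!) (without-⊆ m xs⊆)
      (λ ys! → ¬ys! (¬Any⇒All¬ ys m∉ys ∷ ys!))))

  Unique-⊆-length≥⇒⊇ : ∀ {xs} ys → Unique xs → xs ⊆ₗ ys → length ys ≤ length xs → ys ⊆ₗ xs
  Unique-⊆-length≥⇒⊇ {xs} ys xs! xs⊆ ys≤xs {v} v∈ys with v ∈? xs
  ... | yes v∈xs = v∈xs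
  ... | no v∉xs = ⊥-elim (<⇒≱ (Unique-⊆⇒length≤ ys (¬Any⇒All¬ xs v∉xs ∷ xs!) v∷xs⊆) ys≤xs)
    where
    v∷xs⊆ : v ∷ xs ⊆ₗ ys
    v∷xs⊆ (here refl) = v∈ys
    v∷xs⊆ (there u∈xs) = xs⊆ u∈xs

Unique-tabulate⁻ : ∀ {a} {A : Set a} {k} {f : Fin k → A} → Unique (tabulate f) →
                   ∀ {i j} → f i ≡ f j → i ≡ j
Unique-tabulate⁻ {k = suc k} _ {zero} {zero} _ = refl
Unique-tabulate⁻ {k = suc k} {f} (f₀∉ ∷ _) {zero} {suc j} eq =
  ⊥-elim (All.lookup f₀∉ (∈-tabulate⁺ {f = f ∘ suc} j) eq)
Unique-tabulate⁻ {k = suc k} {f} (f₀∉ ∷ _) {suc i} {zero} eq =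
  ⊥-elim (All.lookup f₀∉ (∈-tabulate⁺ {f = f ∘ suc} i) (sym eq))
Unique-tabulate⁻ {k = suc k} (_ ∷ fs!) {suc i} {suc j} eq = cong suc (Unique-tabulate⁻ fs! eq)

Unique-++⁻ʳ : ∀ {a} {A : Set a} (xs : List A) {ys} → Unique (xs ++ ys) → Unique ys
Unique-++⁻ʳ [] ys! = ys!
Unique-++⁻ʳ (_ ∷ xs) (_ ∷ xsys!) = Unique-++⁻ʳ xs xsys!

Unique-++⁻-disjoint : ∀ {a} {A : Set a} (xs : List A) {ys v} → Unique (xs ++ ys) → v ∈ xs → v ∉ ys
Unique-++⁻-disjoint (_ ∷ xs) (x∉ ∷ _) (here refl) v∈ys = All.lookup (All.++⁻ʳ xs x∉) v∈ys refl
Unique-++⁻-disjoint (_ ∷ xs) (_ ∷ xsys!) (there v∈xs) = Unique-++⁻-disjoint xs xsys! v∈xs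

some-member : ∀ {a} {A : Set a} (xs : List A) → 1 ≤ length xs → ∃[ x ] x ∈ xs
some-member (x ∷ _) _ = x , here refl

two-distinct-members : ∀ {a} {A : Set a} {xs : List A} → Unique xs → 2 ≤ length xs →
                       ∃[ b ] ∃[ c ] b ∈ xs × c ∈ xs × b ≢ c
two-distinct-members {xs = b ∷ c ∷ _} ((b≢c ∷ _) ∷ _) _ = b , c , here refl , there (here refl) , b≢c
two-distinct-members {xs = _ ∷ []} _ (s≤s ())

module _ {p} {P : ℕ → Set p} (P? : ∀ t → Dec (P t)) where

  least-witness : ∀ b {t} → t ≤ b → P t → ∃[ m ] P m × (∀ {s} → s < m → ¬ P s)
  least-witness b {t} t≤b pt with anyUpTo? P? t
  ... | no none = t , pt , λ s<t ps → none (_ , s<t , ps)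
  least-witness zero z≤n _ | yes (_ , () , _)
  least-witness (suc b) t≤b _ | yes (s , s<t , ps) = least-witness b (≤-pred (≤-trans s<t t≤b)) ps

  ∃-transition : ∀ {a b} → a ≤ b → ¬ P a → P b → ∃[ m ] ¬ P m × P (suc m)
  ∃-transition {b = zero} z≤n ¬pa pb = ⊥-elim (¬pa pb)
  ∃-transition {b = suc b} a≤b ¬pa pb with P? b | m≤n⇒m<n∨m≡n a≤b
  ... | no ¬pb | _ = b , ¬pb , pb
  ... | yes pb′ | inj₁ a<b = ∃-transition (≤-pred a<b) ¬pa pb′
  ... | yes _ | inj₂ refl = ⊥-elim (¬pa pb)

2*[2*k]≡3*k+k : ∀ k → 2 * (2 * k) ≡ 3 * k + k
2*[2*k]≡3*k+k = solve-∀

module _ {a} {A : Set a} (d : A → ℕ) where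

  ones : List A → List A
  ones = filter (λ v → d v ≟ℕ 1)

  heavies : List A → List A
  heavies = filter (λ v → 3 ≤? d v)

  private
    2*[1+n]+h≤2+[s+o] : ∀ n h s o → 2 * n + h ≤ s + o → 2 * suc n + h ≤ 2 + (s + o)
    2*[1+n]+h≤2+[s+o] n h _ _ ih = ≤-trans (≤-reflexive (cong (_+ h) (*-suc 2 n))) (s≤s (s≤s ih))

  -- A value 1 is paid for by its entry among the ones, a value ≥ 3 pays for its entry among the heavies.
  2*length+#heavies≤sum+#ones : ∀ vs → All (λ v → 1 ≤ d v) vs →
    2 * length vs + length (heavies vs) ≤ sum (map d vs) + length (ones vs)
  2*length+#heavies≤sum+#ones [] [] = z≤n
  2*length+#heavies≤sum+#ones (v ∷ vs) (1≤dv ∷ 1≤d) with d v | 2*length+#heavies≤sum+#ones vs 1≤d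
  ... | 0 | _ with () ← 1≤dv
  ... | 1 | ih = ≤-trans (2*[1+n]+h≤2+[s+o] (length vs) (length (heavies vs)) (sum (map d vs)) (length (ones vs)) ih)
                         (s≤s (≤-reflexive (sym (+-suc (sum (map d vs)) (length (ones vs))))))
  ... | 2 | ih = 2*[1+n]+h≤2+[s+o] (length vs) (length (heavies vs)) (sum (map d vs)) (length (ones vs)) ih
  ... | suc (suc (suc dv)) | ih = begin
    2 * suc ℓ + suc h    ≡⟨ +-suc (2 * suc ℓ) h ⟩
    suc (2 * suc ℓ + h)  ≤⟨ s≤s (2*[1+n]+h≤2+[s+o] ℓ h s o ih) ⟩
    3 + (s + o)          ≤⟨ +-monoʳ-≤ 3 (+-monoˡ-≤ o (m≤n+m s dv)) ⟩
    3 + (dv + s + o)     ∎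
    where
    open ≤-Reasoning
    ℓ = length vs
    h = length (heavies vs)
    s = sum (map d vs)
    o = length (ones vs)

elements : ∀ {n} → Subset n → List (Fin n)
elements [] = []
elements (true ∷ p) = zero ∷ map suc (elements p)
elements (false ∷ p) = map suc (elements p)

length-elements : ∀ {n} (p : Subset n) → length (elements p) ≡ ∣ p ∣
length-elements [] = refl
length-elements (true ∷ p) = cong suc (trans (length-map suc (elements p)) (length-elements p))
length-elements (false ∷ p) = trans (length-map suc (elements p)) (length-elements p)

∈-elements⁺ : ∀ {n} {p : Subset n} {v} → v ∈ₛ p → v ∈ elements p
∈-elements⁺ {p = true ∷ p} Vec.here = here refl
∈-elements⁺ {p = true ∷ p} (Vec.there v∈p) = there (∈-map⁺ suc (∈-elements⁺ v∈p))
∈-elements⁺ {p = false ∷ p} (Vec.there v∈p) = ∈-map⁺ suc (∈-elements⁺ v∈p)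

∈-elements⁻ : ∀ {n} {p : Subset n} {v} → v ∈ elements p → v ∈ₛ p
∈-elements⁻ {p = true ∷ p} (here refl) = Vec.here
∈-elements⁻ {p = true ∷ p} (there v∈) with ∈-map⁻ suc v∈
... | _ , u∈ , refl = Vec.there (∈-elements⁻ u∈)
∈-elements⁻ {p = false ∷ p} v∈ with ∈-map⁻ suc v∈
... | _ , u∈ , refl = Vec.there (∈-elements⁻ u∈)

elements-Unique : ∀ {n} (p : Subset n) → Unique (elements p)
elements-Unique [] = []
elements-Unique (true ∷ p) = zero∉ (elements p) ∷ map⁺ sucꟳ-injective (elements-Unique p)
  where
  zero∉ : ∀ {n} (vs : List (Fin n)) → All (Fin.zero ≢_) (map Fin.suc vs)
  zero∉ [] = []
  zero∉ (_ ∷ vs) = (λ ()) ∷ zero∉ vs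
elements-Unique (false ∷ p) = map⁺ sucꟳ-injective (elements-Unique p)

module _ {n : ℕ} {p : Subset n} where
  open UniqueSublist (_≟ꟳ_ {n})

  Unique⇒length≤∣∣ : ∀ {vs} → Unique vs → (∀ {v} → v ∈ vs → v ∈ₛ p) → length vs ≤ ∣ p ∣
  Unique⇒length≤∣∣ {vs} vs! vs⊆p = subst (length vs ≤_) (length-elements p)
    (Unique-⊆⇒length≤ (elements p) vs! (∈-elements⁺ ∘ vs⊆p))

  ∣∣≤length : ∀ vs → (∀ {v} → v ∈ₛ p → v ∈ vs) → ∣ p ∣ ≤ length vs
  ∣∣≤length vs p⊆vs = subst (_≤ length vs) (length-elements p)
    (Unique-⊆⇒length≤ vs (elements-Unique p) (p⊆vs ∘ ∈-elements⁻))

  ∣∣<length : ∀ vs → (∀ {v} → v ∈ₛ p → v ∈ vs) → ¬ Unique vs → ∣ p ∣ < length vs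
  ∣∣<length vs p⊆vs ¬vs! = subst (_< length vs) (length-elements p)
    (Unique-⊆-¬Unique⇒length< vs (elements-Unique p) (p⊆vs ∘ ∈-elements⁻) ¬vs!)

  Nonempty⇒1≤∣∣ : Nonempty p → 1 ≤ ∣ p ∣
  Nonempty⇒1≤∣∣ (v , v∈p) = Unique⇒length≤∣∣ ([] ∷ []) λ { (here refl) → v∈p }

  1≤∣∣⇒Nonempty : 1 ≤ ∣ p ∣ → Nonempty p
  1≤∣∣⇒Nonempty 1≤∣p∣
    with v , v∈ ← some-member (elements p) (≤-trans 1≤∣p∣ (≤-reflexive (sym (length-elements p))))
    = v , ∈-elements⁻ v∈

_≟ₛ_ : ∀ {n} → DecidableEquality (Subset n)
_≟ₛ_ = Vec-≡-dec Bool._≟_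

p⊆q∧x∉p⇒p⊆q-x : ∀ {n} {p q : Subset n} {x} → p ⊆ q → x ∉ₛ p → p ⊆ q - x
p⊆q∧x∉p⇒p⊆q-x p⊆q x∉p v∈p = x∈p∧x≢y⇒x∈p-y (p⊆q v∈p) λ { refl → x∉p v∈p }

triple : ∀ {n} → Fin n → Fin n → Fin n → Subset n
triple a b c = ⁅ a ⁆ ∪ ⁅ b ⁆ ∪ ⁅ c ⁆

module _ {n : ℕ} {a b c : Fin n} where

  ∈-triple⁻ : ∀ {v} → v ∈ₛ triple a b c → v ≡ a ⊎ v ≡ b ⊎ v ≡ c
  ∈-triple⁻ v∈ with x∈p∪q⁻ ⁅ a ⁆ _ v∈
  ... | inj₁ v∈a = inj₁ (x∈⁅y⁆⇒x≡y a v∈a)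
  ... | inj₂ v∈bc with x∈p∪q⁻ ⁅ b ⁆ _ v∈bc
  ...   | inj₁ v∈b = inj₂ (inj₁ (x∈⁅y⁆⇒x≡y b v∈b))
  ...   | inj₂ v∈c = inj₂ (inj₂ (x∈⁅y⁆⇒x≡y c v∈c))

  ∈-triple₁ : a ∈ₛ triple a b c
  ∈-triple₁ = x∈p∪q⁺ (inj₁ (x∈⁅x⁆ a))

  ∈-triple₂ : b ∈ₛ triple a b c
  ∈-triple₂ = x∈p∪q⁺ (inj₂ (x∈p∪q⁺ (inj₁ (x∈⁅x⁆ b))))

  ∈-triple₃ : c ∈ₛ triple a b c
  ∈-triple₃ = x∈p∪q⁺ (inj₂ (x∈p∪q⁺ (inj₂ (x∈⁅x⁆ c))))

  ∈-triple⁺ : ∀ {v} → v ≡ a ⊎ v ≡ b ⊎ v ≡ c → v ∈ₛ triple a b c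
  ∈-triple⁺ (inj₁ refl) = ∈-triple₁
  ∈-triple⁺ (inj₂ (inj₁ refl)) = ∈-triple₂
  ∈-triple⁺ (inj₂ (inj₂ refl)) = ∈-triple₃

  triple⊆ : ∀ {p} → a ∈ₛ p → b ∈ₛ p → c ∈ₛ p → triple a b c ⊆ p
  triple⊆ a∈ b∈ c∈ v∈ with ∈-triple⁻ v∈
  ... | inj₁ refl = a∈
  ... | inj₂ (inj₁ refl) = b∈
  ... | inj₂ (inj₂ refl) = c∈

  ∣∣≡3⇒⊆triple : ∀ {e} → ∣ e ∣ ≡ 3 → a ∈ₛ e → b ∈ₛ e → c ∈ₛ e → a ≢ b → a ≢ c → b ≢ c →
                 e ⊆ triple a b c
  ∣∣≡3⇒⊆triple ∣e∣≡3 a∈ b∈ c∈ a≢b a≢c b≢c {v} v∈ with v ≟ꟳ a | v ≟ꟳ b | v ≟ꟳ c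
  ... | yes v≡a | _ | _ = ∈-triple⁺ (inj₁ v≡a)
  ... | no _ | yes v≡b | _ = ∈-triple⁺ (inj₂ (inj₁ v≡b))
  ... | no _ | no _ | yes v≡c = ∈-triple⁺ (inj₂ (inj₂ v≡c))
  ... | no v≢a | no v≢b | no v≢c = ⊥-elim (<⇒≱ (s≤s (≤-reflexive ∣e∣≡3))
        (Unique⇒length≤∣∣ ((v≢a ∷ v≢b ∷ v≢c ∷ []) ∷ (a≢b ∷ a≢c ∷ []) ∷ (b≢c ∷ []) ∷ [] ∷ [])
          λ { (here refl) → v∈ ; (there (here refl)) → a∈ ; (there (there (here refl))) → b∈
            ; (there (there (there (here refl)))) → c∈ }))

  ∣∣≡3⇒≡triple : ∀ {e} → ∣ e ∣ ≡ 3 → a ∈ₛ e → b ∈ₛ e → c ∈ₛ e → a ≢ b → a ≢ c → b ≢ c →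
                 e ≡ triple a b c
  ∣∣≡3⇒≡triple ∣e∣≡3 a∈ b∈ c∈ a≢b a≢c b≢c =
    ⊆-antisym (∣∣≡3⇒⊆triple ∣e∣≡3 a∈ b∈ c∈ a≢b a≢c b≢c) (triple⊆ a∈ b∈ c∈)

triple-swap₁₂ : ∀ {n} {a b c : Fin n} → triple a b c ≡ triple b a c
triple-swap₁₂ = ⊆-antisym swap swap
  where
  swap : ∀ {n} {a b c : Fin n} → triple a b c ⊆ triple b a c
  swap = triple⊆ ∈-triple₂ ∈-triple₁ ∈-triple₃

∈-⋃⁺ : ∀ {m} (ps : List (Subset m)) {p v} → p ∈ ps → v ∈ₛ p → v ∈ₛ ⋃ ps
∈-⋃⁺ (p ∷ ps) (here refl) v∈p = x∈p∪q⁺ (inj₁ v∈p)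
∈-⋃⁺ (q ∷ ps) (there p∈ps) v∈p = x∈p∪q⁺ (inj₂ (∈-⋃⁺ ps p∈ps v∈p))

∈-⋃⁻ : ∀ {m} (ps : List (Subset m)) {v} → v ∈ₛ ⋃ ps → ∃[ p ] p ∈ ps × v ∈ₛ p
∈-⋃⁻ [] v∈ = ⊥-elim (∉⊥ v∈)
∈-⋃⁻ (p ∷ ps) v∈ with x∈p∪q⁻ p (⋃ ps) v∈
... | inj₁ v∈p = p , here refl , v∈p
... | inj₂ v∈⋃ps with q , q∈ , v∈q ← ∈-⋃⁻ ps v∈⋃ps = q , there q∈ , v∈q

-- Vertex–edge incidences

module DoubleCounting {n : ℕ} (F : List (Subset n)) where

  edgesAt : Fin n → List (Subset n)
  edgesAt v = filter (v ∈ₛ?_) F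

  degree : Fin n → ℕ
  degree v = length (edgesAt v)

  ∈-edgesAt⁻ : ∀ {v f} → f ∈ edgesAt v → f ∈ F × v ∈ₛ f
  ∈-edgesAt⁻ {v} = ∈-filter⁻ (v ∈ₛ?_) {xs = F}

  ∈-edgesAt⁺ : ∀ {v f} → f ∈ F → v ∈ₛ f → f ∈ edgesAt v
  ∈-edgesAt⁺ {v} = ∈-filter⁺ (v ∈ₛ?_)

  dartsAt : List (Fin n) → List (Fin n × Subset n)
  dartsAt [] = []
  dartsAt (v ∷ vs) = map (v ,_) (edgesAt v) ++ dartsAt vs

  dartsOf : List (Subset n) → List (Fin n × Subset n)
  dartsOf [] = []
  dartsOf (f ∷ fs) = map (_, f) (elements f) ++ dartsOf fs

  length-dartsAt : ∀ vs → length (dartsAt vs) ≡ sum (map degree vs)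
  length-dartsAt [] = refl
  length-dartsAt (v ∷ vs) = trans (length-++ (map (v ,_) (edgesAt v)))
    (cong₂ _+_ (length-map (v ,_) (edgesAt v)) (length-dartsAt vs))

  length-dartsOf : ∀ fs → length (dartsOf fs) ≡ sum (map ∣_∣ fs)
  length-dartsOf [] = refl
  length-dartsOf (f ∷ fs) = trans (length-++ (map (_, f) (elements f)))
    (cong₂ _+_ (trans (length-map (_, f) (elements f)) (length-elements f)) (length-dartsOf fs))

  ∈-dartsAt⁻ : ∀ vs {v f} → (v , f) ∈ dartsAt vs → v ∈ vs × f ∈ edgesAt v
  ∈-dartsAt⁻ (u ∷ vs) d∈ with ∈-++⁻ (map (u ,_) (edgesAt u)) d∈
  ... | inj₁ d∈u with _ , f∈ , refl ← ∈-map⁻ (u ,_) d∈u = here refl , f∈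
  ... | inj₂ d∈vs with v∈ , f∈ ← ∈-dartsAt⁻ vs d∈vs = there v∈ , f∈

  ∈-dartsOf⁺ : ∀ fs {v f} → f ∈ fs → v ∈ₛ f → (v , f) ∈ dartsOf fs
  ∈-dartsOf⁺ (f ∷ fs) (here refl) v∈f = ∈-++⁺ˡ (∈-map⁺ (_, f) (∈-elements⁺ v∈f))
  ∈-dartsOf⁺ (g ∷ fs) (there f∈) v∈f = ∈-++⁺ʳ (map (_, g) (elements g)) (∈-dartsOf⁺ fs f∈ v∈f)

  dartsAt-Unique : Unique F → ∀ {vs} → Unique vs → Unique (dartsAt vs)
  dartsAt-Unique F! {[]} [] = []
  dartsAt-Unique F! {v ∷ vs} (v∉vs ∷ vs!) =
    ++⁺ (map⁺ (λ { refl → refl }) (filter⁺ (v ∈ₛ?_) F!)) (dartsAt-Unique F! vs!) disjoint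
    where
    disjoint : ∀ {d} → ¬ (d ∈ map (v ,_) (edgesAt v) × d ∈ dartsAt vs)
    disjoint (d∈v , d∈vs) with _ , _ , refl ← ∈-map⁻ (v ,_) d∈v =
      All.lookup v∉vs (proj₁ (∈-dartsAt⁻ vs d∈vs)) refl

  sum-degree≤sum-size : Unique F → ∀ {vs} → Unique vs → sum (map degree vs) ≤ sum (map ∣_∣ F)
  sum-degree≤sum-size F! {vs} vs! = subst₂ _≤_ (length-dartsAt vs) (length-dartsOf F)
    (Unique-⊆⇒length≤ (dartsOf F) (dartsAt-Unique F! vs!) dartsAt⊆dartsOf)
    where
    open UniqueSublist (×-≡-dec _≟ꟳ_ _≟ₛ_) using (Unique-⊆⇒length≤)
    dartsAt⊆dartsOf : dartsAt vs ⊆ₗ dartsOf F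
    dartsAt⊆dartsOf {v , f} d∈ with f∈ , v∈f ← ∈-edgesAt⁻ (proj₂ (∈-dartsAt⁻ vs d∈)) =
      ∈-dartsOf⁺ F f∈ v∈f

module CyclicSuccessor (k : ℕ) .{{_ : NonZero k}} where

  -- Defs indexes cycles by `at H k t`, which is definitionally `t mod k`.
  next : Fin k → Fin k
  next i = suc (toℕ i) mod k

  toℕ-mod : ∀ m → toℕ (m mod k) ≡ m % k
  toℕ-mod m = toℕ-fromℕ< (m%n<n m k)

  toℕ-mod-k : ∀ (i : Fin k) → toℕ i mod k ≡ i
  toℕ-mod-k i = toℕ-injective (trans (toℕ-mod (toℕ i)) (m<n⇒m%n≡m (toℕ<n i)))

  +-k-mod-k : ∀ m → (m + k) mod k ≡ m mod k
  +-k-mod-k m = toℕ-injective (trans (toℕ-mod (m + k)) (trans ([m+n]%n≡m%n m k) (sym (toℕ-mod m))))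

  next-mod-k : ∀ m → next (m mod k) ≡ suc m mod k
  next-mod-k m = toℕ-injective (begin
    toℕ (next (m mod k))     ≡⟨ toℕ-mod _ ⟩
    suc (toℕ (m mod k)) % k  ≡⟨ cong (λ r → suc r % k) (toℕ-mod m) ⟩
    (1 + m % k) % k          ≡⟨ %-distribˡ-+ 1 (m % k) k ⟩
    (1 % k + m % k % k) % k  ≡⟨ cong (λ r → (1 % k + r) % k) (m%n%n≡m%n m k) ⟩
    (1 % k + m % k) % k      ≡⟨ %-distribˡ-+ 1 m k ⟨
    suc m % k                ≡⟨ toℕ-mod (suc m) ⟨
    toℕ (suc m mod k)        ∎)
    where open ≡-Reasoning

  toℕ-next : ∀ i → suc (toℕ i) < k × toℕ (next i) ≡ suc (toℕ i)
                  ⊎ suc (toℕ i) ≡ k × toℕ (next i) ≡ 0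
  toℕ-next i with m≤n⇒m<n∨m≡n (toℕ<n i)
  ... | inj₁ i+1<k = inj₁ (i+1<k , trans (toℕ-mod _) (m<n⇒m%n≡m i+1<k))
  ... | inj₂ i+1≡k = inj₂ (i+1≡k , trans (toℕ-mod _) (trans (cong (_% k) i+1≡k) (n%n≡0 k)))

  next-injective : ∀ {i j} → next i ≡ next j → i ≡ j
  next-injective {i} {j} ni≡nj with toℕ-next i | toℕ-next j | cong toℕ ni≡nj
  ... | inj₁ (_ , ni) | inj₁ (_ , nj) | eq = toℕ-injective (suc-injective (trans (sym ni) (trans eq nj)))
  ... | inj₁ (_ , ni) | inj₂ (_ , nj) | eq = ⊥-elim (1+n≢0 (trans (sym ni) (trans eq nj)))
  ... | inj₂ (_ , ni) | inj₁ (_ , nj) | eq = ⊥-elim (1+n≢0 (trans (sym nj) (trans (sym eq) ni)))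
  ... | inj₂ (i+1≡k , _) | inj₂ (j+1≡k , _) | _ = toℕ-injective (suc-injective (trans i+1≡k (sym j+1≡k)))

  next≢id : 2 ≤ k → ∀ i → next i ≢ i
  next≢id 2≤k i ni≡i with toℕ-next i | cong toℕ ni≡i
  ... | inj₁ (_ , ni) | eq = 1+n≢n (trans (sym ni) eq)
  ... | inj₂ (i+1≡k , ni) | eq = <⇒≢ 2≤k (trans (cong suc (trans (sym ni) eq)) i+1≡k)

  next²≢id : 3 ≤ k → ∀ i → next (next i) ≢ i
  next²≢id 3≤k i nni≡i with toℕ-next i | toℕ-next (next i) | cong toℕ nni≡i
  ... | inj₁ (_ , ni) | inj₁ (_ , nni) | eq =
    <⇒≢ (m≤n⇒m≤1+n (n<1+n (toℕ i))) (sym (trans (cong suc (sym ni)) (trans (sym nni) eq)))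
  ... | inj₁ (_ , ni) | inj₂ (ni+1≡k , nni) | eq =
    <⇒≢ 3≤k (sym (trans (sym ni+1≡k) (cong suc (trans ni (cong suc (trans (sym eq) nni))))))
  ... | inj₂ (i+1≡k , ni) | inj₁ (_ , nni) | eq =
    <⇒≢ 3≤k (sym (trans (sym i+1≡k) (cong suc (trans (sym eq) (trans nni (cong suc ni))))))
  ... | inj₂ (_ , ni) | inj₂ (ni+1≡k , _) | _ =
    <⇒≢ (≤-trans (s≤s (s≤s z≤n)) 3≤k) (trans (cong suc (sym ni)) ni+1≡k)

  ∀-mod⇒∀ : ∀ {p} {P : Fin k → Set p} → (∀ m → P (m mod k)) → ∀ i → P i
  ∀-mod⇒∀ {P = P} P-mod i = subst P (toℕ-mod-k i) (P-mod (toℕ i))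

  cyclic-crossing : ∀ {q} {Q : Fin k → Set q} → (∀ i → Dec (Q i)) →
                    ∀ {i j} → ¬ Q i → Q j → ∃[ a ] ¬ Q a × Q (next a)
  cyclic-crossing {Q = Q} Q? {i} {j} ¬Qi Qj
    with m , ¬Qm , Qm+1 ← ∃-transition (λ t → Q? (t mod k)) {toℕ i} {toℕ j + k}
           (≤-trans (<⇒≤ (toℕ<n i)) (m≤n+m k (toℕ j)))
           (λ Qi → ¬Qi (subst Q (toℕ-mod-k i) Qi))
           (subst Q (sym (trans (+-k-mod-k (toℕ j)) (toℕ-mod-k j))) Qj)
    = m mod k , ¬Qm , subst Q (sym (next-mod-k m)) Qm+1

module HypergraphProperties (H : Hypergraph) where
  open UniqueSublist (_≟ₛ_ {n H}) using (Unique-⊆⇒length≤)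

  edgesIn : Subset (n H) → List (Subset (n H))
  edgesIn X = filter (_⊆? X) (edges H)

  ∈-edgesIn⁻ : ∀ {X e} → e ∈ edgesIn X → e ∈ edges H × e ⊆ X
  ∈-edgesIn⁻ {X} = ∈-filter⁻ (_⊆? X) {xs = edges H}

  ∈-edgesIn⁺ : ∀ {X e} → e ∈ edges H → e ⊆ X → e ∈ edgesIn X
  ∈-edgesIn⁺ {X} = ∈-filter⁺ (_⊆? X)

  edgesIn-Unique : ∀ X → Unique (edgesIn X)
  edgesIn-Unique X = filter⁺ (_⊆? X) (edges-uniq H)

  ∣edge∣≡3 : ∀ {e} → e ∈ edges H → ∣ e ∣ ≡ 3
  ∣edge∣≡3 = All.lookup (edges-3 H)

  length≤weight : ∀ X {es} → Unique es → (∀ {e} → e ∈ es → e ∈ edges H × e ⊆ X) → length es ≤ weight H X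
  length≤weight X es! es⊆ =
    Unique-⊆⇒length≤ (edgesIn X) es! (λ e∈ → ∈-edgesIn⁺ (proj₁ (es⊆ e∈)) (proj₂ (es⊆ e∈)))

  Modest⇒2*weight≤ : ∀ {l} → Modest H l → ∀ {X} → Nonempty X → ∣ X ∣ ≤ 2 * l → 2 * weight H X ≤ ∣ X ∣
  Modest⇒2*weight≤ modest X≠∅ ∣X∣≤2l = ≮⇒≥ (modest _ X≠∅ ∣X∣≤2l)

  1≤weight⇒Nonempty : ∀ Y → 1 ≤ weight H Y → Nonempty Y
  1≤weight⇒Nonempty Y 1≤w
    with f , f∈ ← some-member (edgesIn Y) 1≤w
    with f∈E , f⊆Y ← ∈-edgesIn⁻ f∈
    with v , v∈f ← 1≤∣∣⇒Nonempty (≤-trans (s≤s z≤n) (≤-reflexive (sym (∣edge∣≡3 f∈E))))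
    = v , f⊆Y v∈f

-- Witnessed cycles are minimal dense

module CycleOfEdges (H : Hypergraph) {l} (modest : Modest H l) (k : ℕ) .{{_ : NonZero k}} (k≤l : k ≤ l)
  (x y : Fin k → Fin (n H)) (x-injective : ∀ {i j} → x i ≡ x j → i ≡ j) where
  open HypergraphProperties H
  open CyclicSuccessor k
  open UniqueSublist (_≟ₛ_ {n H}) using (Unique-⊆⇒length≤; Unique-⊆-length≥⇒⊇)
  open import Data.List.Relation.Unary.Unique.DecPropositional (_≟ꟳ_ {n H}) using (unique?)

  e : Fin k → Subset (n H)
  e i = triple (x i) (x (next i)) (y i)

  V : Subset (n H)
  V = ⋃ (tabulate (λ i → ⁅ x i ⁆ ∪ ⁅ y i ⁆))

  ∈V⁻ : ∀ {v} → v ∈ₛ V → ∃[ i ] (v ≡ x i ⊎ v ≡ y i)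
  ∈V⁻ v∈V with p , p∈ , v∈p ← ∈-⋃⁻ (tabulate (λ i → ⁅ x i ⁆ ∪ ⁅ y i ⁆)) v∈V
             with i , refl ← ∈-tabulate⁻ p∈
             with x∈p∪q⁻ ⁅ x i ⁆ _ v∈p
  ... | inj₁ v∈x = i , inj₁ (x∈⁅y⁆⇒x≡y _ v∈x)
  ... | inj₂ v∈y = i , inj₂ (x∈⁅y⁆⇒x≡y _ v∈y)

  x∈V : ∀ i → x i ∈ₛ V
  x∈V i = ∈-⋃⁺ (tabulate (λ i → ⁅ x i ⁆ ∪ ⁅ y i ⁆)) (∈-tabulate⁺ i) (x∈p∪q⁺ (inj₁ (x∈⁅x⁆ _)))

  y∈V : ∀ i → y i ∈ₛ V
  y∈V i = ∈-⋃⁺ (tabulate (λ i → ⁅ x i ⁆ ∪ ⁅ y i ⁆)) (∈-tabulate⁺ i) (x∈p∪q⁺ (inj₂ (x∈⁅x⁆ _)))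

  e⊆V : ∀ i → e i ⊆ V
  e⊆V i = triple⊆ (x∈V i) (x∈V (next i)) (y∈V i)

  V-Nonempty : Nonempty V
  V-Nonempty = x (0 mod k) , x∈V (0 mod k)

  vertexList : List (Fin (n H))
  vertexList = tabulate x ++ tabulate y

  length-vertexList : length vertexList ≡ 2 * k
  length-vertexList = begin
    length (tabulate x ++ tabulate y)          ≡⟨ length-++ (tabulate x) ⟩
    length (tabulate x) + length (tabulate y)  ≡⟨ cong₂ _+_ (length-tabulate x) (length-tabulate y) ⟩
    k + k                                      ≡⟨ cong (k +_) (+-identityʳ k) ⟨
    2 * k                                      ∎
    where open ≡-Reasoning

  V⊆vertexList : ∀ {v} → v ∈ₛ V → v ∈ vertexList
  V⊆vertexList v∈V with ∈V⁻ v∈V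
  ... | i , inj₁ refl = ∈-++⁺ˡ (∈-tabulate⁺ i)
  ... | i , inj₂ refl = ∈-++⁺ʳ (tabulate x) (∈-tabulate⁺ i)

  ∣V∣≤2k : ∣ V ∣ ≤ 2 * k
  ∣V∣≤2k = subst (∣ V ∣ ≤_) length-vertexList (∣∣≤length vertexList V⊆vertexList)

  module _ (3≤k : 3 ≤ k) (edge : ∀ i → e i ∈ edges H)
           (no-triangle : ∀ i → ¬ IsEdge H (x i) (x (next i)) (x (next (next i)))) where

    private
      2≤k : 2 ≤ k
      2≤k = ≤-trans (n≤1+n 2) 3≤k

      ¬e-next : ∀ i → e i ≢ e (next i)
      ¬e-next i ei≡eni with ∈-triple⁻ (subst (x (next (next i)) ∈ₛ_) (sym ei≡eni) ∈-triple₂)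
      ... | inj₁ xnni≡xi = next²≢id 3≤k i (x-injective xnni≡xi)
      ... | inj₂ (inj₁ xnni≡xni) = next≢id 2≤k (next i) (x-injective xnni≡xni)
      ... | inj₂ (inj₂ xnni≡yi) =
        no-triangle i (subst (λ v → IsEdge H (x i) (x (next i)) v) (sym xnni≡yi) (edge i))

    e-injective-of-no-triangle : ∀ {i j} → e i ≡ e j → i ≡ j
    e-injective-of-no-triangle {i} {j} ei≡ej with i ≟ꟳ j | j ≟ꟳ next i | i ≟ꟳ next j
    ... | yes i≡j | _ | _ = i≡j
    ... | no _ | yes refl | _ = ⊥-elim (¬e-next i ei≡ej)
    ... | no _ | no _ | yes refl = ⊥-elim (¬e-next j (sym ei≡ej))
    ... | no i≢j | no j≢ni | no i≢nj
      with ∈-triple⁻ (subst (x j ∈ₛ_) (sym ei≡ej) ∈-triple₁)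
         | ∈-triple⁻ (subst (x (next j) ∈ₛ_) (sym ei≡ej) ∈-triple₂)
    ... | inj₁ xj≡xi | _ = ⊥-elim (i≢j (sym (x-injective xj≡xi)))
    ... | inj₂ (inj₁ xj≡xni) | _ = ⊥-elim (j≢ni (x-injective xj≡xni))
    ... | inj₂ (inj₂ _) | inj₁ xnj≡xi = ⊥-elim (i≢nj (sym (x-injective xnj≡xi)))
    ... | inj₂ (inj₂ _) | inj₂ (inj₁ xnj≡xni) = ⊥-elim (i≢j (sym (next-injective (x-injective xnj≡xni))))
    ... | inj₂ (inj₂ xj≡yi) | inj₂ (inj₂ xnj≡yi) =
      ⊥-elim (next≢id 2≤k j (x-injective (trans xnj≡yi (sym xj≡yi))))

  module WithEdges (edge : ∀ i → e i ∈ edges H) (e-injective : ∀ {i j} → e i ≡ e j → i ≡ j) where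

    tabulate-e⊆edgesIn-V : tabulate e ⊆ₗ edgesIn V
    tabulate-e⊆edgesIn-V f∈ with i , refl ← ∈-tabulate⁻ f∈ = ∈-edgesIn⁺ (edge i) (e⊆V i)

    k≤weight : k ≤ weight H V
    k≤weight = subst (_≤ weight H V) (length-tabulate e)
      (length≤weight V (tabulate⁺ e-injective) (∈-edgesIn⁻ ∘ tabulate-e⊆edgesIn-V))

    2*weight≤∣V∣ : 2 * weight H V ≤ ∣ V ∣
    2*weight≤∣V∣ = Modest⇒2*weight≤ {l} modest V-Nonempty (≤-trans ∣V∣≤2k (*-monoʳ-≤ 2 k≤l))

    ∣V∣≡2k : ∣ V ∣ ≡ 2 * k
    ∣V∣≡2k = ≤-antisym ∣V∣≤2k (≤-trans (*-monoʳ-≤ 2 k≤weight) 2*weight≤∣V∣)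

    weight≡k : weight H V ≡ k
    weight≡k = ≤-antisym (*-cancelˡ-≤ 2 (≤-trans 2*weight≤∣V∣ (≤-reflexive ∣V∣≡2k))) k≤weight

    vertexList-Unique : Unique vertexList
    vertexList-Unique = decidable-stable (unique? vertexList) λ ¬unique →
      <⇒≢ (subst (∣ V ∣ <_) length-vertexList (∣∣<length vertexList V⊆vertexList ¬unique)) ∣V∣≡2k

    y-injective : ∀ {i j} → y i ≡ y j → i ≡ j
    y-injective = Unique-tabulate⁻ (Unique-++⁻ʳ (tabulate x) vertexList-Unique)

    x≢y : ∀ i j → x i ≢ y j
    x≢y i j xi≡yj = Unique-++⁻-disjoint (tabulate x) vertexList-Unique (∈-tabulate⁺ i)
      (subst (_∈ tabulate y) (sym xi≡yj) (∈-tabulate⁺ j))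

    edgesIn-V⊆ : edgesIn V ⊆ₗ tabulate e
    edgesIn-V⊆ = Unique-⊆-length≥⇒⊇ (edgesIn V) (tabulate⁺ e-injective) tabulate-e⊆edgesIn-V
      (≤-reflexive (trans weight≡k (sym (length-tabulate e))))

    module _ {Y : Subset (n H)} (Y⊆V : Y ⊆ V) where

      edgeIndicesIn : List (Fin k)
      edgeIndicesIn = filter (λ i → e i ⊆? Y) (allFin k)

      ∈-edgeIndicesIn⁻ : ∀ {i} → i ∈ edgeIndicesIn → e i ⊆ Y
      ∈-edgeIndicesIn⁻ = proj₂ ∘ ∈-filter⁻ (λ i → e i ⊆? Y) {xs = allFin k}

      weight≤#edgeIndicesIn : weight H Y ≤ length edgeIndicesIn
      weight≤#edgeIndicesIn = subst (weight H Y ≤_) (length-map e edgeIndicesIn)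
        (Unique-⊆⇒length≤ (map e edgeIndicesIn) (edgesIn-Unique Y) edgesIn-Y⊆)
        where
        edgesIn-Y⊆ : edgesIn Y ⊆ₗ map e edgeIndicesIn
        edgesIn-Y⊆ f∈ with f∈E , f⊆Y ← ∈-edgesIn⁻ f∈
                      with i , refl ← ∈-tabulate⁻ (edgesIn-V⊆ (∈-edgesIn⁺ f∈E (Y⊆V ∘ f⊆Y)))
                      = ∈-map⁺ e (∈-filter⁺ (λ i → e i ⊆? Y) (∈-allFin i) f⊆Y)

      -- The edges inside Y are the e i with i ∈ I; they contribute 2 ∣ I ∣ distinct vertices y i, x (next i).
      ¬Dense-extra-vertex : ∀ {w} → w ∈ₛ Y → (∀ i → e i ⊆ Y → w ≢ y i × w ≢ x (next i)) → ¬ Dense H Y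
      ¬Dense-extra-vertex {w} w∈Y w-new dense =
        <⇒≱ 2I<∣Y∣ (≤-trans dense (*-monoʳ-≤ 2 weight≤#edgeIndicesIn))
        where
        I = edgeIndicesIn
        I! : Unique I
        I! = filter⁺ (λ i → e i ⊆? Y) (allFin⁺ k)
        owned : List (Fin (n H))
        owned = map y I ++ map (x ∘ next) I
        owned! : Unique owned
        owned! = ++⁺ (map⁺ y-injective I!) (map⁺ (next-injective ∘ x-injective) I!) disjoint
          where
          disjoint : ∀ {v} → ¬ (v ∈ map y I × v ∈ map (x ∘ next) I)
          disjoint (v∈y , v∈xn) with i , _ , refl ← ∈-map⁻ y v∈y
                                with j , _ , yi≡xnj ← ∈-map⁻ (x ∘ next) v∈xn
                                = x≢y (next j) i (sym yi≡xnj)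
        w∉owned : All (w ≢_) owned
        w∉owned = All.tabulate λ v∈ → case ∈-++⁻ (map y I) v∈ of λ where
          (inj₁ v∈y) → case ∈-map⁻ y v∈y of λ where
            (i , i∈ , refl) → proj₁ (w-new i (∈-edgeIndicesIn⁻ i∈))
          (inj₂ v∈xn) → case ∈-map⁻ (x ∘ next) v∈xn of λ where
            (i , i∈ , refl) → proj₂ (w-new i (∈-edgeIndicesIn⁻ i∈))
        owned⊆Y : ∀ {v} → v ∈ w ∷ owned → v ∈ₛ Y
        owned⊆Y (here refl) = w∈Y
        owned⊆Y (there v∈) with ∈-++⁻ (map y I) v∈
        ... | inj₁ v∈y with i , i∈ , refl ← ∈-map⁻ y v∈y = ∈-edgeIndicesIn⁻ i∈ ∈-triple₃
        ... | inj₂ v∈xn with i , i∈ , refl ← ∈-map⁻ (x ∘ next) v∈xn = ∈-edgeIndicesIn⁻ i∈ ∈-triple₂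
        2I<∣Y∣ : 2 * length I < ∣ Y ∣
        2I<∣Y∣ = begin-strict
          2 * length I                                ≡⟨ cong (length I +_) (+-identityʳ (length I)) ⟩
          length I + length I                         ≡⟨ cong₂ _+_ (length-map y I) (length-map (x ∘ next) I) ⟨
          length (map y I) + length (map (x ∘ next) I) ≡⟨ length-++ (map y I) ⟨
          length owned                                <⟨ n<1+n _ ⟩
          length (w ∷ owned)                          ≤⟨ Unique⇒length≤∣∣ (w∉owned ∷ owned!) owned⊆Y ⟩
          ∣ Y ∣                                       ∎
          where open ≤-Reasoning

    ¬Dense-proper : ∀ Y → Y ⊆ V → Y ≢ V → Nonempty Y → ¬ Dense H Y
    ¬Dense-proper Y Y⊆V Y≢V (w , w∈Y) with any? (λ i → e i ⊆? Y) | all? (λ i → e i ⊆? Y)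
    ... | no none | _ = ¬Dense-extra-vertex Y⊆V w∈Y λ i ei⊆Y → ⊥-elim (none (i , ei⊆Y))
    ... | yes _ | yes every = ⊥-elim (Y≢V (⊆-antisym Y⊆V V⊆Y))
      where
      V⊆Y : V ⊆ Y
      V⊆Y v∈V with ∈V⁻ v∈V
      ... | i , inj₁ refl = every i ∈-triple₁
      ... | i , inj₂ refl = every i ∈-triple₃
    ... | yes (j , ej⊆Y) | no ¬every
      with i , ¬ei⊆Y ← ¬∀⟶∃¬ k _ (λ i → e i ⊆? Y) ¬every
      with a , ¬ea⊆Y , ena⊆Y ← cyclic-crossing (λ i → e i ⊆? Y) ¬ei⊆Y ej⊆Y
      = ¬Dense-extra-vertex Y⊆V (ena⊆Y ∈-triple₁) λ i ei⊆Y →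
          x≢y (next a) i ,
          λ xna≡xni → ¬ea⊆Y (subst (λ b → e b ⊆ Y) (sym (next-injective (x-injective xna≡xni))) ei⊆Y)

    cycle-MinimalDense : MinimalDense H V × ∣ V ∣ ≡ 2 * k
    cycle-MinimalDense =
      (V-Nonempty , ≤-trans (≤-reflexive ∣V∣≡2k) (*-monoʳ-≤ 2 k≤weight) , ¬Dense-proper) , ∣V∣≡2k

  open WithEdges public

WitnessedCycle⇒MinimalDense : ∀ {l} (H : Hypergraph) → Modest H l → ∀ k → k ≤ l → (C : WitnessedCycle H k) →
                              MinimalDense H (cycleVertices H C) × ∣ cycleVertices H C ∣ ≡ 2 * k
WitnessedCycle⇒MinimalDense H modest 2 2≤l
  record { x = x ; y = y ; cond = x₁≢x₂ , y₁≢y₂ , y₁≢x₁ , y₁≢x₂ , _ , _ , x₁x₂y₁ , x₁x₂y₂ } =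
  cycle-MinimalDense edge e-injective
  where
  x-injective : ∀ {i j} → x i ≡ x j → i ≡ j
  x-injective {zero} {zero} _ = refl
  x-injective {zero} {suc zero} x₁≡x₂ = ⊥-elim (x₁≢x₂ x₁≡x₂)
  x-injective {suc zero} {zero} x₂≡x₁ = ⊥-elim (x₁≢x₂ (sym x₂≡x₁))
  x-injective {suc zero} {suc zero} _ = refl
  open CycleOfEdges H modest 2 2≤l x y x-injective
  edge : ∀ i → e i ∈ edges H
  edge zero = x₁x₂y₁
  edge (suc zero) = subst (_∈ edges H) triple-swap₁₂ x₁x₂y₂
  y₁∉e₂ : y zero ∉ₛ e (suc zero)
  y₁∉e₂ y₁∈ with ∈-triple⁻ y₁∈
  ... | inj₁ y₁≡x₂ = y₁≢x₂ y₁≡x₂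
  ... | inj₂ (inj₁ y₁≡x₁) = y₁≢x₁ y₁≡x₁
  ... | inj₂ (inj₂ y₁≡y₂) = y₁≢y₂ y₁≡y₂
  e-injective : ∀ {i j} → e i ≡ e j → i ≡ j
  e-injective {zero} {zero} _ = refl
  e-injective {zero} {suc zero} e₁≡e₂ = ⊥-elim (y₁∉e₂ (subst (y zero ∈ₛ_) e₁≡e₂ ∈-triple₃))
  e-injective {suc zero} {zero} e₂≡e₁ = ⊥-elim (y₁∉e₂ (subst (y zero ∈ₛ_) (sym e₂≡e₁) ∈-triple₃))
  e-injective {suc zero} {suc zero} _ = refl
WitnessedCycle⇒MinimalDense H modest k@(suc (suc (suc _))) k≤l
  record { x = x ; y = y ; cond = x-injective , edgeℕ , no-triangleℕ } =
  cycle-MinimalDense edge (e-injective-of-no-triangle (s≤s (s≤s (s≤s z≤n))) edge no-triangle)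
  where
  open CyclicSuccessor k
  open CycleOfEdges H modest k k≤l x y x-injective
  edge-mod : ∀ m → e (m mod k) ∈ edges H
  edge-mod m rewrite next-mod-k m = edgeℕ m
  no-triangle-mod : ∀ m → ¬ IsEdge H (x (m mod k)) (x (next (m mod k))) (x (next (next (m mod k))))
  no-triangle-mod m rewrite next-mod-k m | next-mod-k (suc m) = no-triangleℕ m
  edge : ∀ i → e i ∈ edges H
  edge = ∀-mod⇒∀ edge-mod
  no-triangle : ∀ i → ¬ IsEdge H (x i) (x (next i)) (x (next (next i)))
  no-triangle = ∀-mod⇒∀ no-triangle-mod

witnessedCycleCond : ∀ (H : Hypergraph) k .{{_ : NonZero k}} → 2 ≤ k → (x y : Fin k → Fin (n H)) →
  let open CyclicSuccessor k in
  (∀ {i j} → x i ≡ x j → i ≡ j) → (∀ {i j} → y i ≡ y j → i ≡ j) → (∀ i j → x i ≢ y j) →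
  (∀ i → IsEdge H (x i) (x (next i)) (y i)) →
  (3 ≤ k → ∀ i → ¬ IsEdge H (x i) (x (next i)) (x (next (next i)))) →
  WitnessedCycleCond H k x y
witnessedCycleCond H 1 (s≤s ())
witnessedCycleCond H 2 _ x y x-injective y-injective x≢y edge _ =
  (λ x₁≡x₂ → case x-injective x₁≡x₂ of λ ()) , (λ y₁≡y₂ → case y-injective y₁≡y₂ of λ ()) ,
  (x≢y zero zero ∘ sym) , (x≢y (suc zero) zero ∘ sym) ,
  (x≢y zero (suc zero) ∘ sym) , (x≢y (suc zero) (suc zero) ∘ sym) ,
  edge zero , subst (_∈ edges H) triple-swap₁₂ (edge (suc zero))
witnessedCycleCond H k@(suc (suc (suc _))) _ x y x-injective _ _ edge no-triangle =
  x-injective , edgeℕ , no-triangleℕ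
  where
  open CyclicSuccessor k
  edgeℕ : ∀ t → IsEdge H (x (t mod k)) (x (suc t mod k)) (y (t mod k))
  edgeℕ t rewrite sym (next-mod-k t) = edge (t mod k)
  no-triangleℕ : ∀ t → ¬ IsEdge H (x (t mod k)) (x (suc t mod k)) (x (suc (suc t) mod k))
  no-triangleℕ t rewrite sym (next-mod-k (suc t)) | sym (next-mod-k t) =
    no-triangle (s≤s (s≤s (s≤s z≤n))) (t mod k)

-- Minimal dense sets are witnessed cycles

module MinimalDenseSet (H : Hypergraph) {l} (modest : Modest H l) (k : ℕ) (k≤l : k ≤ l)
  {X : Subset (n H)} (minimal : MinimalDense H X) (∣X∣≡2k : ∣ X ∣ ≡ 2 * k) where
  open HypergraphProperties H

  F : List (Subset (n H))
  F = edgesIn X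

  open DoubleCounting F using (edgesAt; degree; ∈-edgesAt⁻; ∈-edgesAt⁺; sum-degree≤sum-size)
  open UniqueSublist (_≟ₛ_ {n H})
    using (without; ∈-without⁻; length≤1+length-without; Unique-⊆⇒length≤; Unique-⊆-length≥⇒⊇)

  X-Nonempty : Nonempty X
  X-Nonempty = proj₁ minimal

  ¬Dense-⊂ : ∀ {Y} → Y ⊂ X → 1 ≤ weight H Y → ¬ Dense H Y
  ¬Dense-⊂ {Y} Y⊂X 1≤w =
    proj₂ (proj₂ minimal) Y (proj₁ Y⊂X) (λ Y≡X → ⊂-irref Y≡X Y⊂X) (1≤weight⇒Nonempty Y 1≤w)

  F! : Unique F
  F! = edgesIn-Unique X

  ∈F⁻ : ∀ {f} → f ∈ F → f ∈ edges H × f ⊆ X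
  ∈F⁻ = ∈-edgesIn⁻

  ∣f∣≡3 : ∀ {f} → f ∈ F → ∣ f ∣ ≡ 3
  ∣f∣≡3 = ∣edge∣≡3 ∘ proj₁ ∘ ∈F⁻

  #F≡k : length F ≡ k
  #F≡k = *-cancelˡ-≡ _ _ 2 (≤-antisym
    (≤-trans (Modest⇒2*weight≤ {l} modest X-Nonempty (≤-trans (≤-reflexive ∣X∣≡2k) (*-monoʳ-≤ 2 k≤l)))
             (≤-reflexive ∣X∣≡2k))
    (≤-trans (≤-reflexive (sym ∣X∣≡2k)) (proj₁ (proj₂ minimal))))

  1≤k : 1 ≤ k
  1≤k = *-cancelˡ-< 2 0 k (≤-trans (Nonempty⇒1≤∣∣ X-Nonempty) (≤-reflexive ∣X∣≡2k))

  some-edge : ∃[ f ] f ∈ F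
  some-edge = some-member F (≤-trans 1≤k (≤-reflexive (sym #F≡k)))

  2≤k : 2 ≤ k
  2≤k with f , f∈F ← some-edge = *-cancelˡ-< 2 1 k (begin
    3      ≡⟨ ∣f∣≡3 f∈F ⟨
    ∣ f ∣  ≤⟨ p⊆q⇒∣p∣≤∣q∣ (proj₂ (∈F⁻ f∈F)) ⟩
    ∣ X ∣  ≡⟨ ∣X∣≡2k ⟩
    2 * k  ∎)
    where open ≤-Reasoning

  2≤degree : ∀ {v f g} → f ∈ F → g ∈ F → v ∈ₛ f → v ∈ₛ g → f ≢ g → 2 ≤ degree v
  2≤degree {v} f∈F g∈F v∈f v∈g f≢g = Unique-⊆⇒length≤ (edgesAt v) ((f≢g ∷ []) ∷ [] ∷ [])
    λ { (here refl) → ∈-edgesAt⁺ f∈F v∈f ; (there (here refl)) → ∈-edgesAt⁺ g∈F v∈g }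

  Private : Fin (n H) → Set
  Private v = degree v ≡ 1

  Private⇒unique-edge : ∀ {v f g} → Private v → f ∈ F → g ∈ F → v ∈ₛ f → v ∈ₛ g → f ≡ g
  Private⇒unique-edge {f = f} {g} deg≡1 f∈F g∈F v∈f v∈g = decidable-stable (f ≟ₛ g) λ f≢g →
    <⇒≱ (s≤s (≤-reflexive deg≡1)) (2≤degree f∈F g∈F v∈f v∈g f≢g)

  1≤degree : ∀ {v} → v ∈ₛ X → 1 ≤ degree v
  1≤degree {v} v∈X with 1 ≤? degree v
  ... | yes 1≤deg = 1≤deg
  ... | no deg≡0 = ⊥-elim (¬Dense-⊂ (x∈p⇒p-x⊂p v∈X) (≤-trans 1≤k k≤weight) dense)
    where
    v∉F : ∀ {f} → f ∈ F → v ∉ₛ f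
    v∉F f∈F v∈f = deg≡0 (Unique-⊆⇒length≤ (edgesAt v) ([] ∷ []) λ { (here refl) → ∈-edgesAt⁺ f∈F v∈f })
    k≤weight : k ≤ weight H (X - v)
    k≤weight = subst (_≤ weight H (X - v)) #F≡k (length≤weight (X - v) F!
      λ f∈F → proj₁ (∈F⁻ f∈F) , p⊆q∧x∉p⇒p⊆q-x (proj₂ (∈F⁻ f∈F)) (v∉F f∈F))
    dense : Dense H (X - v)
    dense = ≤-trans (<⇒≤ (x∈p⇒∣p-x∣<∣p∣ v∈X)) (≤-trans (≤-reflexive ∣X∣≡2k) (*-monoʳ-≤ 2 k≤weight))

  -- Deleting two private vertices of one edge loses only that edge, and leaves a dense proper subset.
  ¬two-private : ∀ {f u w} → f ∈ F → u ∈ₛ f → w ∈ₛ f → u ≢ w → Private u → Private w → ⊥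
  ¬two-private {f} {u} {w} f∈F u∈f w∈f u≢w u-private w-private =
    ¬Dense-⊂ Y⊂X (≤-trans (≤-pred (≤-trans 2≤k k≤1+#others)) #others≤weight) dense
    where
    Y = X - u - w
    u∈X = proj₂ (∈F⁻ f∈F) u∈f
    w∈X-u = x∈p∧x≢y⇒x∈p-y (proj₂ (∈F⁻ f∈F) w∈f) (u≢w ∘ sym)
    Y⊂X : Y ⊂ X
    Y⊂X = ⊂-⊆-trans (x∈p⇒p-x⊂p w∈X-u) (p─q⊆p X ⁅ u ⁆)
    others = without f F
    others⊆Y : ∀ {g} → g ∈ others → g ∈ edges H × g ⊆ Y
    others⊆Y g∈ with g∈F , g≢f ← ∈-without⁻ f g∈ with g∈E , g⊆X ← ∈F⁻ g∈F =
      g∈E , p⊆q∧x∉p⇒p⊆q-x (p⊆q∧x∉p⇒p⊆q-x g⊆X (λ u∈g → g≢f (Private⇒unique-edge u-private g∈F f∈F u∈g u∈f)))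
                          (λ w∈g → g≢f (Private⇒unique-edge w-private g∈F f∈F w∈g w∈f))
    k≤1+#others : k ≤ suc (length others)
    k≤1+#others = subst (_≤ suc (length others)) #F≡k (length≤1+length-without f F!)
    #others≤weight : length others ≤ weight H Y
    #others≤weight = length≤weight Y (filter⁺ _ F!) others⊆Y
    2+∣Y∣≤2k : 2 + ∣ Y ∣ ≤ 2 * k
    2+∣Y∣≤2k = ≤-trans (s≤s (x∈p⇒∣p-x∣<∣p∣ w∈X-u)) (≤-trans (x∈p⇒∣p-x∣<∣p∣ u∈X) (≤-reflexive ∣X∣≡2k))
    dense : Dense H Y
    dense = ≤-trans (+-cancelˡ-≤ 2 _ _ (begin
      2 + ∣ Y ∣                    ≤⟨ 2+∣Y∣≤2k ⟩
      2 * k                        ≤⟨ *-monoʳ-≤ 2 k≤1+#others ⟩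
      2 * suc (length others)      ≡⟨ *-suc 2 (length others) ⟩
      2 + 2 * length others        ∎)) (*-monoʳ-≤ 2 #others≤weight)
      where open ≤-Reasoning

  edgesAtAll : List (Fin (n H)) → List (Subset (n H))
  edgesAtAll [] = []
  edgesAtAll (v ∷ vs) = edgesAt v ++ edgesAtAll vs

  ∈-edgesAtAll⁻ : ∀ vs {f} → f ∈ edgesAtAll vs → ∃[ v ] v ∈ vs × f ∈ edgesAt v
  ∈-edgesAtAll⁻ (v ∷ vs) f∈ with ∈-++⁻ (edgesAt v) f∈
  ... | inj₁ f∈v = v , here refl , f∈v
  ... | inj₂ f∈vs with w , w∈vs , f∈w ← ∈-edgesAtAll⁻ vs f∈vs = w , there w∈vs , f∈w

  module _ {vs} (vs-private : All Private vs) where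

    length-edgesAtAll : length (edgesAtAll vs) ≡ length vs
    length-edgesAtAll = go vs-private
      where
      go : ∀ {us} → All Private us → length (edgesAtAll us) ≡ length us
      go [] = refl
      go {u ∷ us} (u-private ∷ us-private) =
        trans (length-++ (edgesAt u)) (cong₂ _+_ u-private (go us-private))

    edgesAtAll-Unique : Unique vs → Unique (edgesAtAll vs)
    edgesAtAll-Unique = go vs-private
      where
      go : ∀ {us} → All Private us → Unique us → Unique (edgesAtAll us)
      go [] [] = []
      go {u ∷ us} (u-private ∷ us-private) (u∉us ∷ us!) =
        ++⁺ (filter⁺ (u ∈ₛ?_) F!) (go us-private us!) disjoint
        where
        disjoint : ∀ {f} → ¬ (f ∈ edgesAt u × f ∈ edgesAtAll us)
        disjoint (f∈u , f∈us) with w , w∈us , f∈w ← ∈-edgesAtAll⁻ us f∈us =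
          ¬two-private (proj₁ (∈-edgesAt⁻ f∈u)) (proj₂ (∈-edgesAt⁻ f∈u)) (proj₂ (∈-edgesAt⁻ f∈w))
            (λ { refl → All.lookup u∉us w∈us refl }) u-private (All.lookup us-private w∈us)

  edgesAtAll⊆F : ∀ vs → edgesAtAll vs ⊆ₗ F
  edgesAtAll⊆F vs f∈ with _ , _ , f∈v ← ∈-edgesAtAll⁻ vs f∈ = proj₁ (∈-edgesAt⁻ f∈v)

  privates : List (Fin (n H))
  privates = ones degree (elements X)

  privates-Private : All Private privates
  privates-Private = All.all-filter (λ v → degree v ≟ℕ 1) (elements X)

  privateEdges : List (Subset (n H))
  privateEdges = edgesAtAll privates

  privateEdges-Unique : Unique privateEdges
  privateEdges-Unique = edgesAtAll-Unique privates-Private (filter⁺ _ (elements-Unique X))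

  #privates≤k : length privates ≤ k
  #privates≤k = subst₂ _≤_ (length-edgesAtAll privates-Private) #F≡k
    (Unique-⊆⇒length≤ F privateEdges-Unique (edgesAtAll⊆F privates))

  sum-degree≤3k : sum (map degree (elements X)) ≤ 3 * k
  sum-degree≤3k = ≤-trans (sum-degree≤sum-size F! (elements-Unique X))
    (≤-reflexive (trans (sum-sizes F (λ f∈F → ∣f∣≡3 f∈F)) (cong (3 *_) #F≡k)))
    where
    sum-sizes : ∀ fs → (∀ {f} → f ∈ fs → ∣ f ∣ ≡ 3) → sum (map ∣_∣ fs) ≡ 3 * length fs
    sum-sizes [] _ = refl
    sum-sizes (f ∷ fs) sizes = trans (cong₂ _+_ (sizes (here refl)) (sum-sizes fs (sizes ∘ there)))
                                     (sym (*-suc 3 (length fs)))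

  -- Degrees are ≥ 2 except at the ≤ k private vertices, and they sum to 3k over the 2k vertices of X:
  -- so there are exactly k private vertices and no vertex of degree ≥ 3.
  no-heavies×#privates≡k : length (heavies degree (elements X)) ≡ 0 × length privates ≡ k
  no-heavies×#privates≡k = arithmetic (begin
    2 * (2 * k) + #heavies
      ≡⟨ cong (λ m → 2 * m + #heavies) (trans (sym ∣X∣≡2k) (sym (length-elements X))) ⟩
    2 * length (elements X) + #heavies
      ≤⟨ 2*length+#heavies≤sum+#ones degree (elements X) (All.tabulate (1≤degree ∘ ∈-elements⁻)) ⟩
    sum (map degree (elements X)) + length privates
      ≤⟨ +-monoˡ-≤ _ sum-degree≤3k ⟩
    3 * k + length privates ∎) #privates≤k
    where
    open ≤-Reasoning
    #heavies = length (heavies degree (elements X))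
    arithmetic : ∀ {h p} → 2 * (2 * k) + h ≤ 3 * k + p → p ≤ k → h ≡ 0 × p ≡ k
    arithmetic {h} {p} 4k+h≤3k+p p≤k =
      n≤0⇒n≡0 (+-cancelˡ-≤ k h 0 (≤-trans k+h≤p (≤-trans p≤k (≤-reflexive (sym (+-identityʳ k)))))) ,
      ≤-antisym p≤k (≤-trans (m≤m+n k h) k+h≤p)
      where
      k+h≤p : k + h ≤ p
      k+h≤p = +-cancelˡ-≤ (3 * k) (k + h) p (begin
        3 * k + (k + h)    ≡⟨ +-assoc (3 * k) k h ⟨
        3 * k + k + h      ≡⟨ cong (_+ h) (2*[2*k]≡3*k+k k) ⟨
        2 * (2 * k) + h    ≤⟨ 4k+h≤3k+p ⟩
        3 * k + p          ∎)

  degree≤2 : ∀ {v} → v ∈ₛ X → degree v ≤ 2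
  degree≤2 {v} v∈X with 3 ≤? degree v
  ... | no ¬3≤deg = ≤-pred (≰⇒> ¬3≤deg)
  ... | yes 3≤deg = ⊥-elim (<⇒≢ (∈-length v∈heavies) (sym (proj₁ no-heavies×#privates≡k)))
    where
    v∈heavies = ∈-filter⁺ (λ v → 3 ≤? degree v) (∈-elements⁺ v∈X) 3≤deg

  F⊆privateEdges : F ⊆ₗ privateEdges
  F⊆privateEdges = Unique-⊆-length≥⇒⊇ F privateEdges-Unique (edgesAtAll⊆F privates)
    (≤-reflexive (trans #F≡k (sym (trans (length-edgesAtAll privates-Private) (proj₂ no-heavies×#privates≡k)))))

  opaque
    private-in-edge : ∀ {f} → f ∈ F → ∃[ p ] p ∈ₛ f × Private p
    private-in-edge f∈F with p , p∈privates , f∈p ← ∈-edgesAtAll⁻ privates (F⊆privateEdges f∈F) =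
      p , proj₂ (∈-edgesAt⁻ f∈p) , All.lookup privates-Private p∈privates

  ¬Private⇒degree≡2 : ∀ {v} → v ∈ₛ X → ¬ Private v → degree v ≡ 2
  ¬Private⇒degree≡2 {v} v∈X ¬private with degree v | 1≤degree v∈X | degree≤2 v∈X
  ... | 1 | _ | _ = ⊥-elim (¬private refl)
  ... | 2 | _ | _ = refl
  ... | suc (suc (suc _)) | _ | s≤s (s≤s ())

  nonprivate-in-edge : ∀ {f a b c} → f ∈ F → a ∈ₛ f → b ∈ₛ f → c ∈ₛ f → a ≢ b →
                       ¬ Private a → ¬ Private b → ¬ Private c → c ≡ a ⊎ c ≡ b
  nonprivate-in-edge f∈F a∈f b∈f c∈f a≢b ¬pa ¬pb ¬pc
    with p , p∈f , pp ← private-in-edge f∈F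
    with ∈-triple⁻ (∣∣≡3⇒⊆triple (∣f∣≡3 f∈F) a∈f b∈f p∈f a≢b (¬pa ∘ λ a≡p → subst Private (sym a≡p) pp)
                                                          (¬pb ∘ λ b≡p → subst Private (sym b≡p) pp) c∈f)
  ... | inj₁ c≡a = inj₁ c≡a
  ... | inj₂ (inj₁ c≡b) = inj₂ c≡b
  ... | inj₂ (inj₂ c≡p) = ⊥-elim (¬pc (subst Private (sym c≡p) pp))

  edge-at-nonprivate : ∀ {q f g h} → q ∈ₛ X → ¬ Private q → f ∈ F → g ∈ F → h ∈ F →
                       q ∈ₛ f → q ∈ₛ g → q ∈ₛ h → f ≢ g → h ≡ f ⊎ h ≡ g
  edge-at-nonprivate {q} {f} {g} {h} q∈X ¬pq f∈F g∈F h∈F q∈f q∈g q∈h f≢g with h ≟ₛ f | h ≟ₛ g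
  ... | yes h≡f | _ = inj₁ h≡f
  ... | no _ | yes h≡g = inj₂ h≡g
  ... | no h≢f | no h≢g = ⊥-elim (<⇒≱ (s≤s (≤-reflexive (¬Private⇒degree≡2 q∈X ¬pq)))
        (Unique-⊆⇒length≤ (edgesAt q) ((f≢g ∷ (h≢f ∘ sym) ∷ []) ∷ ((h≢g ∘ sym) ∷ []) ∷ [] ∷ [])
          λ { (here refl) → ∈-edgesAt⁺ f∈F q∈f ; (there (here refl)) → ∈-edgesAt⁺ g∈F q∈g
            ; (there (there (here refl))) → ∈-edgesAt⁺ h∈F q∈h }))

  module Vertices = UniqueSublist (_≟ꟳ_ {n H})

  2≤#elements-without : ∀ {f a} → f ∈ F → 2 ≤ length (Vertices.without a (elements f))
  2≤#elements-without {f} {a} f∈F = ≤-pred (begin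
    3                                              ≡⟨ trans (length-elements f) (∣f∣≡3 f∈F) ⟨
    length (elements f)                            ≤⟨ Vertices.length≤1+length-without a (elements-Unique f) ⟩
    suc (length (Vertices.without a (elements f))) ∎)
    where open ≤-Reasoning

  another-nonprivate : ∀ {f a} → f ∈ F → a ∈ₛ f → ∃[ r ] r ∈ₛ f × r ≢ a × ¬ Private r
  another-nonprivate {f} {a} f∈F a∈f
    with b , c , b∈ , c∈ , b≢c ← two-distinct-members (filter⁺ _ (elements-Unique f)) (2≤#elements-without f∈F)
    with b∈f , b≢a ← Vertices.∈-without⁻ a b∈ | c∈f , c≢a ← Vertices.∈-without⁻ a c∈
    with degree b ≟ℕ 1 | degree c ≟ℕ 1
  ... | no ¬pb | _ = b , ∈-elements⁻ b∈f , b≢a , ¬pb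
  ... | yes _ | no ¬pc = c , ∈-elements⁻ c∈f , c≢a , ¬pc
  ... | yes pb | yes pc = ⊥-elim (¬two-private f∈F (∈-elements⁻ b∈f) (∈-elements⁻ c∈f) b≢c pb pc)

  1≤#other-edges : ∀ {q f} → q ∈ₛ X → ¬ Private q → 1 ≤ length (without f (edgesAt q))
  1≤#other-edges {q} {f} q∈X ¬pq = ≤-pred (≤-trans (≤-reflexive (sym (¬Private⇒degree≡2 q∈X ¬pq)))
                                                  (length≤1+length-without f (filter⁺ _ F!)))

  another-edge : ∀ {q f} → q ∈ₛ X → ¬ Private q → f ∈ F → q ∈ₛ f → ∃[ g ] g ∈ F × q ∈ₛ g × g ≢ f
  another-edge {q} {f} q∈X ¬pq f∈F q∈f
    with g , g∈ ← some-member (without f (edgesAt q)) (1≤#other-edges q∈X ¬pq)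
    with g∈q , g≢f ← ∈-without⁻ f g∈
    = g , proj₁ (∈-edgesAt⁻ g∈q) , proj₂ (∈-edgesAt⁻ g∈q) , g≢f

  ¬Private-triangle : ∀ {a b c} → ¬ Private a → ¬ Private b → ¬ Private c →
                      a ∈ₛ X → b ∈ₛ X → c ∈ₛ X → ¬ IsEdge H a b c
  ¬Private-triangle ¬pa ¬pb ¬pc a∈X b∈X c∈X abc∈E
    with p , p∈abc , pp ← private-in-edge (∈-edgesIn⁺ abc∈E (triple⊆ a∈X b∈X c∈X))
    with ∈-triple⁻ p∈abc
  ... | inj₁ p≡a = ¬pa (subst Private p≡a pp)
  ... | inj₂ (inj₁ p≡b) = ¬pb (subst Private p≡b pp)
  ... | inj₂ (inj₂ p≡c) = ¬pc (subst Private p≡c pp)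

  record Position : Set where
    constructor position
    field
      vertex : Fin (n H)
      edge : Subset (n H)
      edge∈F : edge ∈ F
      vertex∈edge : vertex ∈ₛ edge
      nonprivate : ¬ Private vertex

  Follows : Position → Position → Set
  Follows σ τ = Position.vertex τ ∈ₛ Position.edge σ × Position.vertex τ ≢ Position.vertex σ ×
                Position.edge τ ≢ Position.edge σ

  opaque
    step : ∀ σ → ∃[ τ ] Follows σ τ
    step (position v f f∈F v∈f _)
      with r , r∈f , r≢v , ¬pr ← another-nonprivate f∈F v∈f
      with g , g∈F , r∈g , g≢f ← another-edge (proj₂ (∈F⁻ f∈F) r∈f) ¬pr f∈F r∈f
      = position r g g∈F r∈g ¬pr , r∈f , r≢v , g≢f

  opaque
    start : Position
    start with f , f∈F ← some-edge
          with p , p∈f , _ ← private-in-edge f∈F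
          with r , r∈f , _ , ¬pr ← another-nonprivate f∈F p∈f
          = position r f f∈F r∈f ¬pr

  walk : ℕ → Position
  walk zero = start
  walk (suc t) = proj₁ (step (walk t))

  q : ℕ → Fin (n H)
  q t = Position.vertex (walk t)

  e : ℕ → Subset (n H)
  e t = Position.edge (walk t)

  e∈F : ∀ t → e t ∈ F
  e∈F t = Position.edge∈F (walk t)

  q∈e : ∀ t → q t ∈ₛ e t
  q∈e t = Position.vertex∈edge (walk t)

  q-nonprivate : ∀ t → ¬ Private (q t)
  q-nonprivate t = Position.nonprivate (walk t)

  q∈X : ∀ t → q t ∈ₛ X
  q∈X t = proj₂ (∈F⁻ (e∈F t)) (q∈e t)

  q-suc∈e : ∀ t → q (suc t) ∈ₛ e t
  q-suc∈e t = proj₁ (proj₂ (step (walk t)))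

  q-suc≢ : ∀ t → q (suc t) ≢ q t
  q-suc≢ t = proj₁ (proj₂ (proj₂ (step (walk t))))

  e-suc≢ : ∀ t → e (suc t) ≢ e t
  e-suc≢ t = proj₂ (proj₂ (proj₂ (step (walk t))))

  nonprivate-in-e : ∀ t {c} → c ∈ₛ e t → ¬ Private c → c ≡ q t ⊎ c ≡ q (suc t)
  nonprivate-in-e t c∈ ¬pc = nonprivate-in-edge (e∈F t) (q∈e t) (q-suc∈e t) c∈ (q-suc≢ t ∘ sym)
    (q-nonprivate t) (q-nonprivate (suc t)) ¬pc

  Repeats : ℕ → Set
  Repeats t = ∃[ s ] s < t × q s ≡ q t

  Repeats? : ∀ t → Dec (Repeats t)
  Repeats? t = anyUpTo? (λ s → q s ≟ꟳ q t) t

  first-repeat : ∃[ m ] Repeats m × (∀ {t} → t < m → ¬ Repeats t)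
  first-repeat with i , j , i<j , qi≡qj ← pigeonhole (n<1+n (n H)) (q ∘ toℕ)
    = least-witness Repeats? (n H) (≤-pred (toℕ<n j)) (toℕ i , i<j , qi≡qj)

  m : ℕ
  m = proj₁ first-repeat

  no-repeat-below-m : ∀ {t} → t < m → ¬ Repeats t
  no-repeat-below-m = proj₂ (proj₂ first-repeat)

  q-injective-below-m : ∀ {i j} → i < m → j < m → q i ≡ q j → i ≡ j
  q-injective-below-m {i} {j} i<m j<m qi≡qj with <-cmp i j
  ... | tri< i<j _ _ = ⊥-elim (no-repeat-below-m j<m (i , i<j , qi≡qj))
  ... | tri≈ _ i≡j _ = i≡j
  ... | tri> _ _ j<i = ⊥-elim (no-repeat-below-m i<m (j , j<i , sym qi≡qj))

  -- q (suc s) lies on e s and e (suc s) only, so a walk returning to it at time suc M arrives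
  -- along one of these two edges, and q M repeats an earlier vertex.
  repeat-at-start : ∀ {s M} → s < M → q s ≡ q M → (∀ {t} → t < M → ¬ Repeats t) → s ≡ 0
  repeat-at-start {zero} _ _ _ = refl
  repeat-at-start {suc s} {suc M} (s≤s s<M) qs+1≡qM+1 no-repeat-below =
    ⊥-elim ([ arrive-along-es , arrive-along-es+1 ]′ (edge-at-nonprivate (q∈X (suc s)) (q-nonprivate (suc s))
      (e∈F s) (e∈F (suc s)) (e∈F M) (q-suc∈e s) (q∈e (suc s)) (subst (_∈ₛ e M) (sym qs+1≡qM+1) (q-suc∈e M))
      (e-suc≢ s ∘ sym)))
    where
    qM≢qs+1 : q M ≢ q (suc s)
    qM≢qs+1 qM≡qs+1 = q-suc≢ M (trans (sym qs+1≡qM+1) (sym qM≡qs+1))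
    arrive-along-es : e M ≡ e s → ⊥
    arrive-along-es eM≡es with nonprivate-in-e s (subst (q M ∈ₛ_) eM≡es (q∈e M)) (q-nonprivate M)
    ... | inj₁ qM≡qs = no-repeat-below (n<1+n M) (s , s<M , sym qM≡qs)
    ... | inj₂ qM≡qs+1 = qM≢qs+1 qM≡qs+1
    arrive-along-es+1 : e M ≡ e (suc s) → ⊥
    arrive-along-es+1 eM≡es+1 with nonprivate-in-e (suc s) (subst (q M ∈ₛ_) eM≡es+1 (q∈e M)) (q-nonprivate M)
    ... | inj₁ qM≡qs+1 = qM≢qs+1 qM≡qs+1
    ... | inj₂ qM≡qs+2 with <-cmp (suc (suc s)) M
    ...   | tri< s+2<M _ _ = no-repeat-below (n<1+n M) (suc (suc s) , s+2<M , sym qM≡qs+2)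
    ...   | tri≈ _ s+2≡M _ = e-suc≢ (suc s) (subst (λ t → e t ≡ e (suc s)) (sym s+2≡M) eM≡es+1)
    ...   | tri> _ _ M<s+2 = qM≢qs+1 (cong q (≤-antisym (≤-pred M<s+2) s<M))

  q-m≡q-0 : q m ≡ q 0
  q-m≡q-0 with s , s<m , qs≡qm ← proj₁ (proj₂ first-repeat) =
    trans (sym qs≡qm) (cong q (repeat-at-start s<m qs≡qm no-repeat-below-m))

  2≤m : 2 ≤ m
  2≤m with m | q-m≡q-0 | proj₁ (proj₂ first-repeat)
  ... | 0 | _ | _ , () , _
  ... | 1 | q1≡q0 | _ = ⊥-elim (q-suc≢ 0 q1≡q0)
  ... | suc (suc _) | _ | _ = s≤s (s≤s z≤n)

  e-distinct-below-m : ∀ {i j} → i < j → j < m → e i ≢ e j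
  e-distinct-below-m {i} {j} i<j j<m ei≡ej
    with nonprivate-in-e i (subst (q j ∈ₛ_) (sym ei≡ej) (q∈e j)) (q-nonprivate j)
  ... | inj₁ qj≡qi = <⇒≢ i<j (q-injective-below-m (<-trans i<j j<m) j<m (sym qj≡qi))
  ... | inj₂ qj≡qi+1 with m≤n⇒m<n∨m≡n i<j
  ...   | inj₁ i+1<j = no-repeat-below-m j<m (suc i , i+1<j , sym qj≡qi+1)
  ...   | inj₂ i+1≡j = e-suc≢ i (trans (cong e i+1≡j) (sym ei≡ej))

  e-injective-below-m : ∀ {i j} → i < m → j < m → e i ≡ e j → i ≡ j
  e-injective-below-m {i} {j} i<m j<m ei≡ej with <-cmp i j
  ... | tri< i<j _ _ = ⊥-elim (e-distinct-below-m i<j j<m ei≡ej)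
  ... | tri≈ _ i≡j _ = i≡j
  ... | tri> _ _ j<i = ⊥-elim (e-distinct-below-m j<i i<m (sym ei≡ej))

  m≤k : m ≤ k
  m≤k = subst₂ _≤_ (length-applyUpTo e m) #F≡k (Unique-⊆⇒length≤ F
    (applyUpTo⁺₁ e m λ i<j j<m → e-distinct-below-m i<j j<m)
    (λ f∈ → case ∈-applyUpTo⁻ e f∈ of λ { (i , _ , refl) → e∈F i }))

  y : ℕ → Fin (n H)
  y t = proj₁ (private-in-edge (e∈F t))

  y∈e : ∀ t → y t ∈ₛ e t
  y∈e t = proj₁ (proj₂ (private-in-edge (e∈F t)))

  y-private : ∀ t → Private (y t)
  y-private t = proj₂ (proj₂ (private-in-edge (e∈F t)))

  q≢y : ∀ s t → q s ≢ y t
  q≢y s t qs≡yt = q-nonprivate s (subst Private (sym qs≡yt) (y-private t))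

  e≡triple : ∀ t → e t ≡ triple (q t) (q (suc t)) (y t)
  e≡triple t =
    ∣∣≡3⇒≡triple (∣f∣≡3 (e∈F t)) (q∈e t) (q-suc∈e t) (y∈e t) (q-suc≢ t ∘ sym) (q≢y t t) (q≢y (suc t) t)

  instance
    m-nonZero : NonZero m
    m-nonZero = >-nonZero (≤-trans (s≤s z≤n) 2≤m)

  open CyclicSuccessor m

  x-cycle : Fin m → Fin (n H)
  x-cycle i = q (toℕ i)

  y-cycle : Fin m → Fin (n H)
  y-cycle i = y (toℕ i)

  x-cycle-injective : ∀ {i j} → x-cycle i ≡ x-cycle j → i ≡ j
  x-cycle-injective = toℕ-injective ∘ q-injective-below-m (toℕ<n _) (toℕ<n _)

  x-cycle-next : ∀ i → x-cycle (next i) ≡ q (suc (toℕ i))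
  x-cycle-next i with toℕ-next i
  ... | inj₁ (_ , ni≡i+1) = cong q ni≡i+1
  ... | inj₂ (i+1≡m , ni≡0) = trans (cong q ni≡0) (trans (sym q-m≡q-0) (cong q (sym i+1≡m)))

  module Cycle = CycleOfEdges H modest m (≤-trans m≤k k≤l) x-cycle y-cycle x-cycle-injective

  cycle-e≡e : ∀ i → Cycle.e i ≡ e (toℕ i)
  cycle-e≡e i = trans (cong (λ v → triple (x-cycle i) v (y-cycle i)) (x-cycle-next i)) (sym (e≡triple (toℕ i)))

  cycle-edge : ∀ i → Cycle.e i ∈ edges H
  cycle-edge i = subst (_∈ edges H) (sym (cycle-e≡e i)) (proj₁ (∈F⁻ (e∈F (toℕ i))))

  cycle-e-injective : ∀ {i j} → Cycle.e i ≡ Cycle.e j → i ≡ j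
  cycle-e-injective {i} {j} ei≡ej = toℕ-injective
    (e-injective-below-m (toℕ<n i) (toℕ<n j) (trans (sym (cycle-e≡e i)) (trans ei≡ej (cycle-e≡e j))))

  module ClosedCycle = Cycle.WithEdges cycle-edge cycle-e-injective

  cycle-V⊆X : Cycle.V ⊆ X
  cycle-V⊆X v∈V with Cycle.∈V⁻ v∈V
  ... | i , inj₁ refl = q∈X (toℕ i)
  ... | i , inj₂ refl = proj₂ (∈F⁻ (e∈F (toℕ i))) (y∈e (toℕ i))

  cycle-V≡X : Cycle.V ≡ X
  cycle-V≡X = decidable-stable (Cycle.V ≟ₛ X) λ V≢X →
    proj₂ (proj₂ minimal) Cycle.V cycle-V⊆X V≢X Cycle.V-Nonempty
      (≤-trans Cycle.∣V∣≤2k (*-monoʳ-≤ 2 ClosedCycle.k≤weight))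

  m≡k : m ≡ k
  m≡k = *-cancelˡ-≡ m k 2 (trans (sym ClosedCycle.∣V∣≡2k) (trans (cong ∣_∣ cycle-V≡X) ∣X∣≡2k))

  walkCycle : WitnessedCycle H m
  walkCycle = record
    { x = x-cycle ; y = y-cycle
    ; cond = witnessedCycleCond H m 2≤m x-cycle y-cycle x-cycle-injective ClosedCycle.y-injective ClosedCycle.x≢y
               cycle-edge λ _ i → ¬Private-triangle
                 (q-nonprivate (toℕ i)) (q-nonprivate (toℕ (next i))) (q-nonprivate (toℕ (next (next i))))
                 (q∈X (toℕ i)) (q∈X (toℕ (next i))) (q∈X (toℕ (next (next i)))) }

  minimalDense⇒cycle : Σ (WitnessedCycle H k) (λ C → cycleVertices H C ≡ X)
  minimalDense⇒cycle =
    subst (λ j → Σ (WitnessedCycle H j) (λ C → cycleVertices H C ≡ X)) m≡k (walkCycle , cycle-V≡X)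

theorem2p2p1 : (l : ℕ) → 2 ≤ l → (H : Hypergraph) → Modest H l →
    ((k : ℕ) → 2 * k ≤ 2 * l → (X : Subset (n H)) → MinimalDense H X → ∣ X ∣ ≡ 2 * k →
      Σ (WitnessedCycle H k) (λ C → cycleVertices H C ≡ X))
    ×
    ((k : ℕ) → k ≤ l → (C : WitnessedCycle H k) →
      MinimalDense H (cycleVertices H C) × ∣ cycleVertices H C ∣ ≡ 2 * k)
theorem2p2p1 l _ H modest =
  (λ k 2k≤2l X minimal ∣X∣≡2k →
    MinimalDenseSet.minimalDense⇒cycle H {l} modest k (*-cancelˡ-≤ 2 2k≤2l) minimal ∣X∣≡2k) ,
  WitnessedCycle⇒MinimalDense H modest
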